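{- Let $\mathcal{F}$ be a filter on $\omega$. The game $\mathfrak{G}(\mathrm{Fr},[\omega]^{<\omega},\mathcal{F}^*)$ is equivalent to $\mathfrak{G}(\mathrm{Fr},\omega,\mathcal{F}^*)$ (a player has a winning strategy in one iff the same player has one in the other). Therefore, player I has a winning strategy in $\mathfrak{G}(\mathrm{Fr},[\omega]^{<\omega},\mathcal{F}^*)$ if and only if $\mathcal{F}=\mathrm{Fr}$ if and only if player II has no winning strategy in it.
   Context: A filter on $\omega$ is a family $\mathcal{F}\subseteq\mathcal{P}(\omega)$ closed under finite intersections and supersets and containing all cofinite subsets of $\omega$; $\mathrm{Fr}$ is the filter of cofinite sets. $\mathcal{F}^+=\{X\subseteq\omega: X\cap Y\text{ infinite for all }Y\in\mathcal{F}\}$, $\mathcal{F}^*=\mathcal{P}(\omega)\setminus\mathcal{F}^+$. In $\mathfrak{G}(\mathrm{Fr},\omega,\mathcal{F}^*)$, at each stage $k$ player I chooses a cofinite set $X_k$ and II responds with $n_k\in X_k$; II wins iff $\{n_k:k\in\omega\}\in\mathcal{F}^*$. In $\mathfrak{G}(\mathrm{Fr},[\omega]^{<\omega},\mathcal{F}^*)$, I chooses a cofinite set $X_k$ and II responds with a nonempty finite $s_k\subseteq X_k$; II wins iff $\bigcup_k s_k\in\mathcal{F}^*$. -}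

module Defs where

open import Level using (0ℓ)
open import Data.Nat using (ℕ; _≤_; _<_)
open import Data.List using (List; []; map; upTo)
open import Data.List.Relation.Unary.All using (All)
open import Data.List.Membership.Propositional using (_∈_)
open import Data.Product using (Σ; ∃; _×_; proj₁)
open import Relation.Nullary using (¬_)
open import Relation.Binary.PropositionalEquality using (_≡_; _≢_)
open import Relation.Unary using (Pred; _∩_; _⊆_)
open import Function.Bundles using (_⇔_)

Subset : Set₁
Subset = Pred ℕ 0ℓ

Family : Set₂
Family = Subset → Set₁

Finite : Subset → Set
Finite X = ∃ λ m → ∀ n → X n → n < m

Infinite : Subset → Set
Infinite X = ¬ Finite X

Cofinite : Subset → Set
Cofinite X = ∃ λ m → ∀ n → m ≤ n → X n

record IsFilter (F : Family) : Set₁ where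
  field
    ∩-closed   : ∀ X Y → F X → F Y → F (X ∩ Y)
    ⊇-closed   : ∀ X Y → X ⊆ Y → F X → F Y
    cofinite∈  : ∀ X → Cofinite X → F X

_⁺ : Family → Subset → Set₁
(F ⁺) X = ∀ Y → F Y → Infinite (X ∩ Y)

_* : Family → Subset → Set₁
(F *) X = ¬ (F ⁺) X

IsFr : Family → Set₁
IsFr F = ∀ X → F X ⇔ Cofinite X

CofSet : Set₁
CofSet = Σ Subset Cofinite

prefix : {A : Set₁} → (ℕ → A) → ℕ → List A
prefix f k = map f (upTo k)

prefix₀ : (ℕ → ℕ) → ℕ → List ℕ
prefix₀ f k = map f (upTo k)

prefixL : (ℕ → List ℕ) → ℕ → List (List ℕ)
prefixL f k = map f (upTo k)

range : (ℕ → ℕ) → Subset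
range n m = ∃ λ k → n k ≡ m

bigUnion : (ℕ → List ℕ) → Subset
bigUnion s m = ∃ λ k → m ∈ s k

-- I sees II's previous moves and plays a cofinite set.
StratIω : Set₁
StratIω = List ℕ → CofSet

-- II sees I's previous moves and I's current move X, answers n ∈ X.
StratIIω : Set₁
StratIIω = List CofSet → (X : CofSet) → Σ ℕ (proj₁ X)

WinningIω : Family → StratIω → Set₁
WinningIω F σ = (n : ℕ → ℕ) → (∀ k → proj₁ (σ (prefix₀ n k)) (n k)) → ¬ (F *) (range n)

WinningIIω : Family → StratIIω → Set₁
WinningIIω F τ = (X : ℕ → CofSet) →
  (F *) (range (λ k → proj₁ (τ (prefix X k) (X k))))

-- The game 𝔊(Fr, [ω]^{<ω}, F*)
-- A nonempty finite subset of X is given as a nonempty list of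
-- elements of X.

FinMove : Subset → Set
FinMove X = Σ (List ℕ) λ s → (s ≢ []) × All X s

StratIfin : Set₁
StratIfin = List (List ℕ) → CofSet

StratIIfin : Set₁
StratIIfin = List CofSet → (X : CofSet) → FinMove (proj₁ X)

WinningIfin : Family → StratIfin → Set₁
WinningIfin F σ = (s : ℕ → List ℕ) →
  (∀ k → (s k ≢ []) × All (proj₁ (σ (prefixL s k))) (s k)) →
  ¬ (F *) (bigUnion s)

WinningIIfin : Family → StratIIfin → Set₁
WinningIIfin F τ = (X : ℕ → CofSet) →
  (F *) (bigUnion (λ k → proj₁ (τ (prefix X k) (X k))))

IHasWinω IIHasWinω IHasWinfin IIHasWinfin : Family → Set₁
IHasWinω F = Σ StratIω (WinningIω F)
IIHasWinω F = Σ StratIIω (WinningIIω F)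
IHasWinfin F = Σ StratIfin (WinningIfin F)
IIHasWinfin F = Σ StratIIfin (WinningIIfin F)

-- If F = Fr, player I wins either game by playing {n : k ≤ n} at round k: the
-- outcome is then unbounded, hence meets every cofinite set infinitely often.
-- If some X ∈ F is not cofinite, its complement is unbounded, so II can answer
-- every cofinite move with a single point outside X; the outcome is disjoint
-- from X and therefore not F-positive. Since the two players cannot both have
-- winning strategies, each game is won by I exactly when F = Fr and by II
-- exactly when F ≠ Fr, which makes the two games equivalent.
module Submission where

open import Defs
open import Level using (Level; 0ℓ; suc)
open import Data.Product using (_×_)
open import Relation.Nullary using (¬_)
open import Function.Bundles using (_⇔_)
open import Axiom.ExcludedMiddle using (ExcludedMiddle)

open import Data.Nat using (ℕ; zero; _≤_; _+_)
open import Data.Nat.Properties using (≤-trans; m≤m+n; m≤n+m; <⇒≱)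
open import Data.List using (List; []; _∷_; [_]; map; upTo; _∷ʳ_; length)
open import Data.List.Properties using (map-++; upTo-∷ʳ; length-map; length-upTo)
open import Data.List.Relation.Unary.All using (All; _∷_; [])
open import Data.List.Relation.Unary.Any using (here)
open import Data.List.Membership.Propositional using (_∈_)
open import Data.Product using (Σ; ∃; _,_; proj₁; proj₂)
open import Data.Empty using (⊥; ⊥-elim)
open import Relation.Nullary using (Dec)
open import Relation.Nullary.Decidable using (decidable-stable)
open import Relation.Unary using (_⊆_)
open import Relation.Binary.PropositionalEquality
  using (_≡_; _≢_; refl; sym; cong; subst; module ≡-Reasoning)
open import Function.Base using (_∘_; id)
open import Function.Bundles using (mk⇔; Equivalence)
import Function.Properties.Equivalence as ⇔
open import Axiom.DoubleNegationElimination using (em⇒dne)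

private
  variable
    a : Level
    A : Set a

map-upTo-suc : (f : ℕ → A) (k : ℕ) → map f (upTo (ℕ.suc k)) ≡ map f (upTo k) ∷ʳ f k
map-upTo-suc f k = begin
  map f (upTo (ℕ.suc k))     ≡⟨ cong (map f) (sym (upTo-∷ʳ k)) ⟩
  map f (upTo k ∷ʳ k)        ≡⟨ map-++ f (upTo k) [ k ] ⟩
  map f (upTo k) ∷ʳ f k      ∎
  where open ≡-Reasoning

length-map-upTo : (f : ℕ → A) (k : ℕ) → length (map f (upTo k)) ≡ k
length-map-upTo f k = begin
  length (map f (upTo k))    ≡⟨ length-map f (upTo k) ⟩
  length (upTo k)            ≡⟨ length-upTo k ⟩
  k                          ∎
  where open ≡-Reasoning

Unbounded : Subset → Set
Unbounded U = ∀ k → ∃ λ x → k ≤ x × U x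

above : ℕ → CofSet
above k = (λ n → k ≤ n) , (k , λ _ k≤n → k≤n)

bound : CofSet → ℕ
bound X = proj₁ (proj₂ X)

bound≤⇒∈ : (X : CofSet) {n : ℕ} → bound X ≤ n → proj₁ X n
bound≤⇒∈ X = proj₂ (proj₂ X) _

module _ {F : Family} where

  unbounded⇒⁺ : IsFr F → ∀ {U} → Unbounded U → (F ⁺) U
  unbounded⇒⁺ fr unb Y FY (b , U∩Y<b) with Equivalence.to (fr Y) FY
  ... | m , cofY with unb (m + b)
  ... | x , m+b≤x , Ux =
    <⇒≱ (U∩Y<b x (Ux , cofY x (≤-trans (m≤m+n m b) m+b≤x))) (≤-trans (m≤n+m b m) m+b≤x)

  disjoint⇒* : ∀ {X U} → F X → (∀ n → U n → ¬ X n) → (F *) U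
  disjoint⇒* {X} FX U∩X=∅ U⁺ =
    U⁺ X FX (0 , λ n (Un , Xn) → ⊥-elim (U∩X=∅ n Un Xn))

module _ (em₀ : ExcludedMiddle 0ℓ) where

  ¬Cofinite⇒unbounded-complement : ∀ {X} → ¬ Cofinite X → Unbounded (¬_ ∘ X)
  ¬Cofinite⇒unbounded-complement {X} ¬cof m = em⇒dne em₀ λ ¬gap →
    ¬cof (m , λ n m≤n → em⇒dne em₀ λ ¬Xn → ¬gap (n , m≤n , ¬Xn))

  ¬IsFr⇒non-cofinite-member : ExcludedMiddle (suc 0ℓ) → ∀ {F} → IsFilter F →
    ¬ IsFr F → ∃ λ X → F X × ¬ Cofinite X
  ¬IsFr⇒non-cofinite-member em₁ isF ¬fr = em⇒dne em₁ λ ¬member →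
    ¬fr λ Y → mk⇔ (λ FY → em⇒dne em₀ λ ¬cof → ¬member (Y , FY , ¬cof))
                  (IsFilter.cofinite∈ isF Y)

  ¬IsFr⇒member-with-unbounded-complement : ExcludedMiddle (suc 0ℓ) → ∀ {F} → IsFilter F →
    ¬ IsFr F → ∃ λ X → F X × Unbounded (¬_ ∘ X)
  ¬IsFr⇒member-with-unbounded-complement em₁ isF ¬fr
    with ¬IsFr⇒non-cofinite-member em₁ isF ¬fr
  ... | X , FX , ¬cof = X , FX , ¬Cofinite⇒unbounded-complement ¬cof

-- 𝔊(Fr, M, F*) for moves of type A, where Legal X m says that m is a move in the
-- cofinite set X and outcome collects II's moves into a subset of ω.
module Game {A : Set} (Legal : Subset → A → Set) (outcome : (ℕ → A) → Subset) where

  StratI : Set₁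
  StratI = List A → CofSet

  StratII : Set₁
  StratII = List CofSet → (X : CofSet) → Σ A (Legal (proj₁ X))

  WinningI : Family → StratI → Set₁
  WinningI F σ = (s : ℕ → A) → (∀ k → Legal (proj₁ (σ (map s (upTo k)))) (s k)) →
    ¬ (F *) (outcome s)

  WinningII : Family → StratII → Set₁
  WinningII F τ = (X : ℕ → CofSet) → (F *) (outcome (λ k → proj₁ (τ (map X (upTo k)) (X k))))

  IHasWin IIHasWin : Family → Set₁
  IHasWin F = Σ StratI (WinningI F)
  IIHasWin F = Σ StratII (WinningII F)

  module Play (σ : StratI) (τ : StratII) where

    history : ℕ → List A × List CofSet
    history zero = [] , []
    history (ℕ.suc k) with history k
    ... | ss , Xs = ss ∷ʳ proj₁ (τ Xs (σ ss)) , Xs ∷ʳ σ ss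

    movesI : ℕ → CofSet
    movesI k = σ (proj₁ (history k))

    movesII : ℕ → A
    movesII k = proj₁ (τ (map movesI (upTo k)) (movesI k))

    prefixes≡history : ∀ k → (map movesII (upTo k) , map movesI (upTo k)) ≡ history k
    prefixes≡history zero = refl
    prefixes≡history (ℕ.suc k)
      rewrite map-upTo-suc movesII k | map-upTo-suc movesI k | sym (prefixes≡history k) = refl

    movesII-legal : ∀ k → Legal (proj₁ (σ (map movesII (upTo k)))) (movesII k)
    movesII-legal k rewrite cong proj₁ (prefixes≡history k) =
      proj₂ (τ (map movesI (upTo k)) (movesI k))

  ¬both-win : ∀ {F} → IHasWin F → IIHasWin F → ⊥
  ¬both-win (σ , σ-wins) (τ , τ-wins) = σ-wins movesII movesII-legal (τ-wins movesI)
    where open Play σ τ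

  LegalMovesMeetOutcome : Set₁
  LegalMovesMeetOutcome = ∀ {X} s k → Legal X (s k) → ∃ λ x → X x × outcome s x

  I-wins-if-Fr : LegalMovesMeetOutcome → ∀ {F} → IsFr F → IHasWin F
  I-wins-if-Fr meets fr = (above ∘ length) , λ s legal F*s →
    F*s (unbounded⇒⁺ fr λ k → unbounded s legal k)
    where
    unbounded : ∀ s → (∀ k → Legal (proj₁ (above (length (map s (upTo k))))) (s k)) →
                Unbounded (outcome s)
    unbounded s legal k with meets s k (legal k)
    ... | x , len≤x , x∈s = x , subst (_≤ x) (length-map-upTo s k) len≤x , x∈s

  II-wins-avoiding-member : (single : ℕ → A) → (∀ {X x} → X x → Legal X (single x)) →
    (∀ ns → outcome (single ∘ ns) ⊆ range ns) →
    ∀ {F} → (∃ λ X → F X × Unbounded (¬_ ∘ X)) → IIHasWin F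
  II-wins-avoiding-member single single-legal outcome-single (X , FX , avoid) =
    (λ _ Y → single (point Y) , single-legal (bound≤⇒∈ Y (proj₁ (proj₂ (avoid (bound Y)))))) ,
    λ Ys → disjoint⇒* FX λ n n∈outcome → points∉X Ys (outcome-single (point ∘ Ys) n∈outcome)
    where
    point : CofSet → ℕ
    point Y = proj₁ (avoid (bound Y))
    points∉X : ∀ Ys {n} → range (point ∘ Ys) n → ¬ X n
    points∉X Ys (k , refl) = proj₂ (proj₂ (avoid (bound (Ys k))))

module Classification {P I II : Set₁} (P? : Dec P)
  (P→I : P → I) (¬P→II : ¬ P → II) (¬I×II : I → II → ⊥) where

  I⇔P : I ⇔ P
  I⇔P = mk⇔ (λ i → decidable-stable P? λ ¬p → ¬I×II i (¬P→II ¬p)) P→I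

  II⇔¬P : II ⇔ (¬ P)
  II⇔¬P = mk⇔ (λ ii p → ¬I×II (P→I p) ii) ¬P→II

  P⇔¬II : P ⇔ (¬ II)
  P⇔¬II = mk⇔ (λ p → ¬I×II (P→I p)) (λ ¬ii → decidable-stable P? (¬ii ∘ ¬P→II))

module ωGame = Game (λ X n → X n) range
module FinGame = Game (λ X s → (s ≢ []) × All X s) bigUnion

ω-legal-moves-meet-outcome : ωGame.LegalMovesMeetOutcome
ω-legal-moves-meet-outcome s k s[k]∈X = s k , s[k]∈X , (k , refl)

nonempty-All⇒∃ : ∀ {P : ℕ → Set} {xs} → xs ≢ [] → All P xs → ∃ λ x → x ∈ xs × P x
nonempty-All⇒∃ {xs = []}    []≢[] _          = ⊥-elim ([]≢[] refl)
nonempty-All⇒∃ {xs = x ∷ _} _     (Px ∷ _)  = x , here refl , Px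

fin-legal-moves-meet-outcome : FinGame.LegalMovesMeetOutcome
fin-legal-moves-meet-outcome s k (s[k]≢[] , s[k]⊆X) with nonempty-All⇒∃ s[k]≢[] s[k]⊆X
... | x , x∈s[k] , x∈X = x , x∈X , (k , x∈s[k])

fin-singleton-legal : ∀ {X : Subset} {x} → X x → ([ x ] ≢ []) × All X [ x ]
fin-singleton-legal Xx = (λ ()) , Xx ∷ []

fin-singletons-outcome : ∀ ns → bigUnion (λ k → [ ns k ]) ⊆ range ns
fin-singletons-outcome ns (k , here refl) = k , refl

theorem2p14 : ExcludedMiddle 0ℓ → ExcludedMiddle (suc 0ℓ) →
    (F : Family) → IsFilter F →
    ((IHasWinfin F ⇔ IHasWinω F) × (IIHasWinfin F ⇔ IIHasWinω F))
    × ((IHasWinfin F ⇔ IsFr F) × (IsFr F ⇔ (¬ IIHasWinfin F)))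
theorem2p14 em₀ em₁ F isF =
  (⇔.trans fin.I⇔P (⇔.sym ω.I⇔P) , ⇔.trans fin.II⇔¬P (⇔.sym ω.II⇔¬P)) , (fin.I⇔P , fin.P⇔¬II)
  where
  Fr? : Dec (IsFr F)
  Fr? = em₁

  co-unbounded-member : ¬ IsFr F → ∃ λ X → F X × Unbounded (¬_ ∘ X)
  co-unbounded-member = ¬IsFr⇒member-with-unbounded-complement em₀ em₁ isF

  module ω = Classification Fr? (ωGame.I-wins-if-Fr ω-legal-moves-meet-outcome)
    (ωGame.II-wins-avoiding-member id id (λ _ → id) ∘ co-unbounded-member) ωGame.¬both-win
  module fin = Classification Fr? (FinGame.I-wins-if-Fr fin-legal-moves-meet-outcome)
    (FinGame.II-wins-avoiding-member [_] fin-singleton-legal fin-singletons-outcome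
      ∘ co-unbounded-member)
    FinGame.¬both-win
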